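{- The characteristic series $\mathbf{F}_{\max}$ of the set of closed terms over $\{\mathsf{M}\}$ that are maximal for $\preccurlyeq$ satisfies $$\mathbf{F}_{\max} = \mathsf{M} + \mathsf{M}\mathsf{M} + \mathbf{F}_{\max}\,\bar\star\,\mathbf{F}_{\max} - \mathsf{M}\,\bar\star\,\mathbf{F}_{\max}.$$
   Context: Terms over $\{\mathsf{M}\}$: variables $\mathsf{x}_i$, the constant $\mathsf{M}$, and applications $\mathfrak{t}_1\mathfrak{t}_2$ (binary trees); a term is closed if it contains no variable. $\mathfrak{t}\Rightarrow\mathfrak{t}'$ iff $\mathfrak{t}'$ is obtained from $\mathfrak{t}$ by replacing one subterm $\mathsf{M}\mathfrak{s}$ by $\mathfrak{s}\mathfrak{s}$; $\preccurlyeq$ is its reflexive transitive closure, a partial order on all terms; maximality refers to this poset. Let $\mathbb{K}$ be a field of characteristic zero. A series on terms is a map $\mathbf{F}$ from terms to $\mathbb{K}$, written as a formal sum $\sum_\mathfrak{t}\langle\mathfrak{t},\mathbf{F}\rangle\mathfrak{t}$; the characteristic series of a set $S$ of terms is $\sum_{\mathfrak{t}\in S}\mathfrak{t}$. The product $\bar\star$ is the bilinear extension of application: $\mathbf{F}_1\,\bar\star\,\mathbf{F}_2 := \sum_{\mathfrak{t}_1,\mathfrak{t}_2}\langle\mathfrak{t}_1,\mathbf{F}_1\rangle\langle\mathfrak{t}_2,\mathbf{F}_2\rangle\,\mathfrak{t}_1\mathfrak{t}_2$. -}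

module Defs where

open import Level using (Level; _⊔_)
open import Data.Nat using (ℕ; zero; suc)
open import Data.Product using (Σ; _×_; _,_)
open import Relation.Nullary using (¬_)
open import Relation.Binary.PropositionalEquality using (_≡_)
open import Relation.Binary.Construct.Closure.ReflexiveTransitive using (Star)
open import Algebra.Bundles using (CommutativeRing)

record Field (c ℓ : Level) : Set (Level.suc (c ⊔ ℓ)) where
  field
    commutativeRing : CommutativeRing c ℓ
  open CommutativeRing commutativeRing public
  field
    0≉1     : ¬ (0# ≈ 1#)
    inverse : ∀ x → ¬ (x ≈ 0#) → Σ Carrier λ y → (x * y) ≈ 1#

module _ {c ℓ} (K : Field c ℓ) where
  open Field K

  natK : ℕ → Carrier
  natK zero    = 0#
  natK (suc n) = 1# + natK n

CharZero : ∀ {c ℓ} → Field c ℓ → Set ℓ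
CharZero K = ∀ n → ¬ (natK K (suc n) ≈ 0#)
  where open Field K

infixl 9 _·_
data Term : Set where
  var : ℕ → Term
  M   : Term
  _·_ : Term → Term → Term

data Closed : Term → Set where
  M-closed : Closed M
  ·-closed : ∀ {t u} → Closed t → Closed u → Closed (t · u)

infix 4 _⇒_
data _⇒_ : Term → Term → Set where
  root : ∀ s → (M · s) ⇒ (s · s)
  left : ∀ {t t'} u → t ⇒ t' → (t · u) ⇒ (t' · u)
  right : ∀ t {u u'} → u ⇒ u' → (t · u) ⇒ (t · u')

infix 4 _≼_
_≼_ : Term → Term → Set
_≼_ = Star _⇒_

Maximal : Term → Set
Maximal t = ∀ t' → t ≼ t' → t' ≡ t

ClosedMax : Term → Set
ClosedMax t = Closed t × Maximal t

module Series {c ℓ} (K : Field c ℓ) where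
  open Field K

  Ser : Set c
  Ser = Term → Carrier

  IsCharSeries : ∀ {p} → (Term → Set p) → Ser → Set (p ⊔ ℓ)
  IsCharSeries S F = ∀ t → (S t → F t ≈ 1#) × (¬ S t → F t ≈ 0#)

  serM : Ser
  serM M = 1#
  serM (var _) = 0#
  serM (_ · _) = 0#

  serMM : Ser
  serMM (M · M) = 1#
  serMM M = 0#
  serMM (var _) = 0#
  serMM (var _ · _) = 0#
  serMM ((_ · _) · _) = 0#
  serMM (M · var _) = 0#
  serMM (M · (_ · _)) = 0#

  _⊕_ : Ser → Ser → Ser
  (F ⊕ G) t = F t + G t

  _⊖_ : Ser → Ser → Ser
  (F ⊖ G) t = F t - G t

  _⋆̄_ : Ser → Ser → Ser
  (F ⋆̄ G) (t₁ · t₂) = F t₁ * G t₂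
  (F ⋆̄ G) M = 0#
  (F ⋆̄ G) (var _) = 0#

  _≈ₛ_ : Ser → Ser → Set ℓ
  F ≈ₛ G = ∀ t → F t ≈ G t

-- A closed term is maximal iff no subterm has the form M s with s ≠ M, since M s ⇒ s s is
-- the identity step only for s = M.  Hence the closed maximal terms are M, M M, and the
-- applications t u with t ≠ M and both t and u closed maximal.  Comparing coefficients,
-- the product F ⋆̄ F accounts for every t u, the summand M ⋆̄ F removes the terms M u, and
-- M M is then added back by hand.
module Submission where

open import Defs
open import Data.Product using (_×_; _,_; proj₁; proj₂)
open import Data.Empty using (⊥-elim)
open import Function.Bundles using (_⇔_; mk⇔; Equivalence)
open import Algebra.Bundles using (Ring)
open import Relation.Nullary using (¬_; Dec; yes; no; contradiction)
open import Relation.Nullary.Decidable using (map; _×-dec_)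
open import Relation.Binary.PropositionalEquality using (_≡_; _≢_; refl; cong)
open import Relation.Binary.Construct.Closure.ReflexiveTransitive using (ε; _◅_; gmap)

·-injectiveˡ : ∀ {t u t' u'} → t · u ≡ t' · u' → t ≡ t'
·-injectiveˡ refl = refl

·-injectiveʳ : ∀ {t u t' u'} → t · u ≡ t' · u' → u ≡ u'
·-injectiveʳ refl = refl

isM? : ∀ t → Dec (t ≡ M)
isM? (var _) = no λ ()
isM? M       = yes refl
isM? (_ · _) = no λ ()

Maximal⇒stepFixed : ∀ {t t'} → Maximal t → t ⇒ t' → t' ≡ t
Maximal⇒stepFixed max step = max _ (step ◅ ε)

stepFixed⇒Maximal : ∀ {t} → (∀ {t'} → t ⇒ t' → t' ≡ t) → Maximal t
stepFixed⇒Maximal fixed _  ε              = refl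
stepFixed⇒Maximal fixed t' (step ◅ steps) with fixed step
... | refl = stepFixed⇒Maximal fixed t' steps

Maximal-M : Maximal M
Maximal-M = stepFixed⇒Maximal λ ()

Maximal-MM : Maximal (M · M)
Maximal-MM = stepFixed⇒Maximal λ where
  (root M)    → refl
  (left _ ())
  (right _ ())

Maximal-M·⇒≡M : ∀ {s} → Maximal (M · s) → s ≡ M
Maximal-M·⇒≡M {s} max = ·-injectiveˡ (Maximal⇒stepFixed max (root s))

Maximal-·ˡ : ∀ {t u} → Maximal (t · u) → Maximal t
Maximal-·ˡ {u = u} max t' t≼t' = ·-injectiveˡ (max _ (gmap (_· u) (left u) t≼t'))

Maximal-·ʳ : ∀ {t u} → Maximal (t · u) → Maximal u
Maximal-·ʳ {t} max u' u≼u' = ·-injectiveʳ (max _ (gmap (t ·_) (right t) u≼u'))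

Maximal-· : ∀ {t u} → t ≢ M → Maximal t → Maximal u → Maximal (t · u)
Maximal-· t≢M maxt maxu = stepFixed⇒Maximal λ where
  (root _)       → ⊥-elim (t≢M refl)
  (left u step)  → cong (_· u) (Maximal⇒stepFixed maxt step)
  (right t step) → cong (t ·_) (Maximal⇒stepFixed maxu step)

Closed-·⁻¹ : ∀ {t u} → Closed (t · u) → Closed t × Closed u
Closed-·⁻¹ (·-closed ct cu) = ct , cu

¬ClosedMax-var : ∀ {n} → ¬ ClosedMax (var n)
¬ClosedMax-var (() , _)

ClosedMax-M : ClosedMax M
ClosedMax-M = M-closed , Maximal-M

ClosedMax-M·⇔≡M : ∀ {s} → s ≡ M ⇔ ClosedMax (M · s)
ClosedMax-M·⇔≡M = mk⇔ (λ { refl → ·-closed M-closed M-closed , Maximal-MM })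
                      (λ (_ , max) → Maximal-M·⇒≡M max)

ClosedMax-·⇔ : ∀ {t u} → t ≢ M → (ClosedMax t × ClosedMax u) ⇔ ClosedMax (t · u)
ClosedMax-·⇔ t≢M = mk⇔
  (λ ((ct , maxt) , (cu , maxu)) → ·-closed ct cu , Maximal-· t≢M maxt maxu)
  (λ (ctu , max) → let ct , cu = Closed-·⁻¹ ctu in
                   (ct , Maximal-·ˡ max) , (cu , Maximal-·ʳ max))

closedMax? : ∀ t → Dec (ClosedMax t)
closedMax? (var _)       = no ¬ClosedMax-var
closedMax? M             = yes ClosedMax-M
closedMax? (M · s)       = map ClosedMax-M·⇔≡M (isM? s)
closedMax? (var n · s)   = map (ClosedMax-·⇔ λ ()) (closedMax? (var n) ×-dec closedMax? s)
closedMax? ((a · b) · s) = map (ClosedMax-·⇔ λ ()) (closedMax? (a · b) ×-dec closedMax? s)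

module _ {r ℓ} (R : Ring r ℓ) where
  open Ring R
  open import Algebra.Properties.Ring R using (-0#≈0#; x≈y⇒x∙y⁻¹≈ε)
  open import Relation.Binary.Reasoning.Setoid setoid

  [x+y]-z≈x : ∀ x {y z} → y ≈ z → (x + y) - z ≈ x
  [x+y]-z≈x x {y} {z} y≈z = begin
    (x + y) - z  ≈⟨ +-assoc x y (- z) ⟩
    x + (y - z)  ≈⟨ +-congˡ (x≈y⇒x∙y⁻¹≈ε y≈z) ⟩
    x + 0#       ≈⟨ +-identityʳ x ⟩
    x            ∎

  [x+y]-z≈y : ∀ {x} y {z} → x ≈ 0# → z ≈ 0# → (x + y) - z ≈ y
  [x+y]-z≈y {x} y {z} x≈0 z≈0 = begin
    (x + y) - z    ≈⟨ +-cong (+-congʳ x≈0) (-‿cong z≈0) ⟩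
    (0# + y) - 0#  ≈⟨ +-cong (+-identityˡ y) -0#≈0# ⟩
    y + 0#         ≈⟨ +-identityʳ y ⟩
    y              ∎

module _ {c ℓ} (K : Field c ℓ) where
  open Field K hiding (refl)
  open Series K

  charSeries-× : ∀ {p} {S : Term → Set p} {F : Ser} → IsCharSeries S F →
                 ∀ {t u v} → (S t × S u) ⇔ S v → Dec (S t) → Dec (S u) →
                 F v ≈ F t * F u
  charSeries-× {S = S} {F} isChar {t} {u} {v} St×Su⇔Sv = product
    where
    open Equivalence St×Su⇔Sv
    product : Dec (S t) → Dec (S u) → F v ≈ F t * F u
    product (yes st) (yes su) = trans (proj₁ (isChar v) (to (st , su)))
      (sym (trans (*-cong (proj₁ (isChar t) st) (proj₁ (isChar u) su)) (*-identityˡ 1#)))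
    product (no ¬st) _ = trans (proj₂ (isChar v) (λ sv → ¬st (proj₁ (from sv))))
      (sym (trans (*-congʳ (proj₂ (isChar t) ¬st)) (zeroˡ _)))
    product (yes _) (no ¬su) = trans (proj₂ (isChar v) (λ sv → ¬su (proj₂ (from sv))))
      (sym (trans (*-congˡ (proj₂ (isChar u) ¬su)) (zeroʳ _)))

  module _ {F : Ser} (isChar : IsCharSeries ClosedMax F) where

    charSeries-M· : ∀ s → F (M · s) ≈ serMM (M · s)
    charSeries-M· M       = proj₁ (isChar _) (Equivalence.to ClosedMax-M·⇔≡M refl)
    charSeries-M· (var _) =
      proj₂ (isChar _) λ cm → contradiction (Equivalence.from ClosedMax-M·⇔≡M cm) λ ()
    charSeries-M· (_ · _) =
      proj₂ (isChar _) λ cm → contradiction (Equivalence.from ClosedMax-M·⇔≡M cm) λ ()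

    charSeries-· : ∀ {t u} → t ≢ M → F (t · u) ≈ F t * F u
    charSeries-· {t} {u} t≢M =
      charSeries-× isChar (ClosedMax-·⇔ t≢M) (closedMax? t) (closedMax? u)

proposition3p2p1 : ∀ {c ℓ} (K : Field c ℓ) → CharZero K →
    let open Series K in
    (Fmax : Ser) → IsCharSeries ClosedMax Fmax →
    Fmax ≈ₛ (((serM ⊕ serMM) ⊕ (Fmax ⋆̄ Fmax)) ⊖ (serM ⋆̄ Fmax))
proposition3p2p1 K _ F isChar = coefficient
  where
  open Field K renaming (refl to ≈-refl)
  open Series K

  F[M]≈1 : F M ≈ 1#
  F[M]≈1 = proj₁ (isChar M) ClosedMax-M

  coefficient : F ≈ₛ (((serM ⊕ serMM) ⊕ (F ⋆̄ F)) ⊖ (serM ⋆̄ F))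
  coefficient (var _)       = trans (proj₂ (isChar _) ¬ClosedMax-var)
    (sym (trans ([x+y]-z≈x ring _ ≈-refl) (+-identityʳ 0#)))
  coefficient M             = trans F[M]≈1
    (sym (trans ([x+y]-z≈x ring _ ≈-refl) (+-identityʳ 1#)))
  coefficient (M · s)       = trans (charSeries-M· K isChar s)
    (sym (trans ([x+y]-z≈x ring _ (*-congʳ F[M]≈1)) (+-identityˡ _)))
  coefficient (var _ · _)   = trans (charSeries-· K isChar λ ())
    (sym ([x+y]-z≈y ring _ (+-identityˡ 0#) (zeroˡ _)))
  coefficient ((_ · _) · _) = trans (charSeries-· K isChar λ ())
    (sym ([x+y]-z≈y ring _ (+-identityˡ 0#) (zeroˡ _)))
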